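{- Fix $1\le p\le n$, a $p$-element subset $Y\subseteq[n]$, and $w\in\mathfrak S_n$ with $\{w_1,\dots,w_p\}\le Y$; let $\xi$ be produced by the minimal-lift procedure described in the context with inputs $p,Y,w$. Then: (1) if $1\le i\le n-1$, $i\ne p$, and $w_i<w_{i+1}$, then $\xi_i<\xi_{i+1}$; that is, $\mathrm{Des}(\xi)\subseteq\mathrm{Des}(w)\cup\{p\}$, where $\mathrm{Des}(\eta)=\{1\le i\le n-1:\eta_i>\eta_{i+1}\}$; (2) if $w'\in\mathfrak S_n$ satisfies $w'_i=w_i$ for all $i\le N$ (for some integer $N\le n$) and $\{w'_1,\dots,w'_p\}\le Y$, and $\xi'$ is the output of the minimal-lift procedure with inputs $p,Y,w'$, then $\xi'_i=\xi_i$ for all $i\le N$.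
   Context: For a subset $E\subseteq[n]$, $\tilde e_k$ is its $k$-th smallest element; for $t$-element subsets, $E\le F$ means $\tilde e_k\le\tilde f_k$ for all $k$. Sub-procedure $Q$: inputs are $t$-element subsets $A,B$ with $A\le B$ and $\gamma\in[n]\setminus A$. Put $A'=A\cup\{\gamma\}$, let $q$ be the maximum index, $1\le q\le t+1$, with $\tilde a'_q\not\le\tilde b_{q-1}$ ($\tilde b_0:=0$), output $a'=\tilde a'_q$, and update $A,B$ to $A'$, $B\cup\{a'\}$. Minimal-lift procedure: for $1\le j\le p$, $\xi_j$ is the least element of $Y\setminus\{\xi_1,\dots,\xi_{j-1}\}$ that is $\ge w_j$. Then $\xi_{p+1}$ is the output of $Q$ with $A=\{w_1,\dots,w_p\}$, $B=Y$, $\gamma=w_{p+1}$; for $j>p+1$, $\xi_j$ is the output of $Q$ with the updated $A,B$ of the previous run and $\gamma=w_j$. -}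

module Defs where

open import Data.Nat using (ℕ; zero; suc; _≤_; _<_; _<?_)
open import Data.Nat.Properties using (≤-decTotalOrder; _≟_)
open import Data.List using (List; []; _∷_; length; map; upTo; filter; take; drop; _++_)
open import Data.List.Membership.DecPropositional _≟_ using (_∈?_)
open import Data.Product using (_×_)
open import Relation.Binary.PropositionalEquality using (_≡_)
open import Relation.Nullary using (yes; no)
open import Relation.Nullary.Decidable using (¬?)
import Data.List.Sort.InsertionSort as IS

-- Finite subsets of [n] = {1,…,n} are represented by duplicate-free lists of ℕ
-- (order irrelevant); permutations in 𝔖ₙ by their one-line notation w₁ … wₙ
-- (a list that is a permutation of [1..n]).

range1 : ℕ → List ℕ
range1 n = map suc (upTo n)

sortℕ : List ℕ → List ℕ
sortℕ = IS.sort ≤-decTotalOrder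

nth0 : List ℕ → ℕ → ℕ
nth0 []       _       = 0
nth0 (x ∷ xs) zero    = x
nth0 (x ∷ xs) (suc k) = nth0 xs k

-- 1-based lookup: at xs i = xᵢ  (at xs 0 = 0, out of range = 0)
at : List ℕ → ℕ → ℕ
at xs zero    = 0
at xs (suc i) = nth0 xs i

-- k-th smallest element ẽ_k of a set E (1-based); ẽ₀ := 0
kth : List ℕ → ℕ → ℕ
kth E k = at (sortℕ E) k

_≼_ : List ℕ → List ℕ → Set
E ≼ F = (length E ≡ length F) × (∀ k → 1 ≤ k → k ≤ length E → kth E k ≤ kth F k)

-- Sub-procedure Q.
-- maxQ A' B k = the largest q with 1 ≤ q ≤ k and ã'_q ≰ b̃_{q-1}
-- (i.e. b̃_{q-1} < ã'_q); 0 if there is none.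
maxQ : List ℕ → List ℕ → ℕ → ℕ
maxQ A' B zero = zero
maxQ A' B (suc k) with kth B k <? kth A' (suc k)
... | yes _ = suc k
... | no  _ = maxQ A' B k

-- output of Q on A, B, γ (with |A| = t): a' = ã'_q where A' = A ∪ {γ}
Qout : List ℕ → List ℕ → ℕ → ℕ
Qout A B γ = kth (γ ∷ A) (maxQ (γ ∷ A) B (suc (length A)))

Qrun : List ℕ → List ℕ → List ℕ → List ℕ
Qrun A B []       = []
Qrun A B (γ ∷ gs) = Qout A B γ ∷ Qrun (γ ∷ A) (Qout A B γ ∷ B) gs

-- least element of S that is ≥ x (0 if none exists)
leastGE : List ℕ → ℕ → ℕ
leastGE S x = kth (filter (λ y → x Data.Nat.≤? y) S) 1

greedy : List ℕ → List ℕ → List ℕ → List ℕ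
greedy Y used []       = []
greedy Y used (x ∷ xs) =
  leastGE (filter (λ y → ¬? (y ∈? used)) Y) x
  ∷ greedy Y (leastGE (filter (λ y → ¬? (y ∈? used)) Y) x ∷ used) xs

minLift : ℕ → List ℕ → List ℕ → List ℕ
minLift p Y w = greedy Y [] (take p w) ++ Qrun (take p w) Y (drop p w)

{-# OPTIONS --safe #-}
-- Let atMost v E and atLeast v E count the elements of E that are ≤ v and ≥ v;
-- for sets of equal size, E ≤ F holds iff atMost v F ≤ atMost v E for every v.
--
-- One run of Q on A, B, γ with output x satisfies: x ≤ γ; atMost u B < atMost u A′ for
-- every u ≥ x (so A′ ≤ B ∪ {x}, and the invariant A ≤ B persists); and
-- atMost x A′ ≤ 1 + atMost x B.  If two consecutive inputs γ₁ < γ₂ produced outputs with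
-- x₂ ≤ x₁, the second fact for the second run at u = x₁ (where γ₂ is not counted, since
-- x₁ ≤ γ₁ < γ₂) would contradict the third fact for the first run.
--
-- In the greedy phase, the Hall-type condition "at every threshold v, at least as many
-- unused elements of Y lie above v as remaining entries of w" follows from {w₁,…,w_p} ≤ Y
-- and is preserved by each step, so every step succeeds; if w_j < w_{j+1}, the choice
-- ξ_{j+1} was available at step j and lies above w_j, hence ξ_j < ξ_{j+1}.
--
-- Part (2) holds because the procedure commutes with truncation:
-- take N (minLift p Y w) ≡ minLift p Y (take N w).
module Submission where

open import Defs
open import Data.Nat using (ℕ; zero; suc; _≤_; _<_; _≰_; _≤?_; _<?_; z≤n; s≤s; z<s; pred; _+_; _∸_; >-nonZero)
open import Data.Nat.Properties
open import Data.Product using (_×_; _,_; proj₁; proj₂)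
open import Data.Sum using (inj₁; inj₂)
open import Data.List using (List; []; _∷_; length; filter; _++_; take; drop; map; upTo)
open import Data.List.Properties
  using (take++drop≡id; length-take; length-map; length-upTo; take-take; take-drop; drop-all;
         length-filter; filter-some; filter-accept; filter-reject; filter-none; filter-all)
open import Data.List.Relation.Unary.All as All using (All; []; _∷_)
open import Data.List.Relation.Unary.All.Properties using (++⁻ˡ; map⁺)
open import Data.List.Relation.Unary.Any as Any using (here; there)
open import Data.List.Relation.Unary.AllPairs using (AllPairs; []; _∷_)
open import Data.List.Relation.Unary.Unique.Propositional using (Unique)
import Data.List.Relation.Unary.Unique.Propositional.Properties as Unique
open import Data.List.Relation.Unary.Sorted.TotalOrder.Properties using (Sorted⇒AllPairs)
import Data.List.Sort.InsertionSort.Properties as InsertionSort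
open import Data.List.Membership.Propositional using (_∈_; _∉_)
open import Data.List.Membership.Propositional.Properties using (∈-filter⁺; ∈-filter⁻)
open import Data.List.Membership.DecPropositional _≟_ using (_∈?_)
open import Data.List.Relation.Binary.Permutation.Propositional
  using (_↭_; ↭-refl; ↭-sym; ↭⇒↭ₛ; module PermutationReasoning)
open import Data.List.Relation.Binary.Permutation.Propositional.Properties
  using (↭-length; filter-↭; ∈-resp-↭; All-resp-↭; shift)
open import Relation.Binary.PropositionalEquality.Properties using (setoid)
open import Data.List.Relation.Binary.Permutation.Setoid.Properties (setoid ℕ) using (Unique-resp-↭)
open import Function using (_∘_)
open import Level using (0ℓ)
open import Relation.Binary.Definitions using (tri<; tri≈; tri>)
open import Relation.Binary.PropositionalEquality
  using (_≡_; _≢_; refl; sym; trans; cong; cong₂; subst; subst₂; module ≡-Reasoning)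
open import Relation.Nullary using (¬_; Dec; yes; no; contradiction)
open import Relation.Nullary.Decidable using (¬?)
open import Relation.Unary using (Pred; Decidable)

-- Counting below and above a threshold

count : {P : Pred ℕ 0ℓ} → Decidable P → List ℕ → ℕ
count P? xs = length (filter P? xs)

atMost : ℕ → List ℕ → ℕ
atMost v = count (_≤? v)

atLeast : ℕ → List ℕ → ℕ
atLeast v = count (v ≤?_)

module _ {P : Pred ℕ 0ℓ} (P? : Decidable P) where

  count-accept : ∀ {x} xs → P x → count P? (x ∷ xs) ≡ suc (count P? xs)
  count-accept xs px = cong length (filter-accept P? px)

  count-reject : ∀ {x} xs → ¬ P x → count P? (x ∷ xs) ≡ count P? xs
  count-reject xs ¬px = cong length (filter-reject P? ¬px)

  count-∷ : ∀ x xs → count P? xs ≤ count P? (x ∷ xs)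
  count-∷ x xs with P? x
  ... | yes _ = n≤1+n _
  ... | no  _ = ≤-refl

  count-none : ∀ {xs} → All (¬_ ∘ P) xs → count P? xs ≡ 0
  count-none ¬Ps = cong length (filter-none P? ¬Ps)

  count-↭ : ∀ {xs ys} → xs ↭ ys → count P? xs ≡ count P? ys
  count-↭ xs↭ys = ↭-length (filter-↭ P? xs↭ys)

module _ {P Q : Pred ℕ 0ℓ} (P? : Decidable P) (Q? : Decidable Q) where

  count-mono : ∀ xs → (∀ {x} → x ∈ xs → P x → Q x) → count P? xs ≤ count Q? xs
  count-mono [] _ = z≤n
  count-mono (x ∷ xs) P⇒Q with P? x | Q? x
  ... | yes px | no ¬qx = contradiction (P⇒Q (here refl) px) ¬qx
  ... | yes _  | yes _  = s≤s (count-mono xs (P⇒Q ∘ there))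
  ... | no _   | yes _  = m≤n⇒m≤1+n (count-mono xs (P⇒Q ∘ there))
  ... | no _   | no _   = count-mono xs (P⇒Q ∘ there)

All-nth0 : ∀ {P : Pred ℕ 0ℓ} {xs k} → All P xs → k < length xs → P (nth0 xs k)
All-nth0 {k = zero}  (px ∷ _)  _         = px
All-nth0 {k = suc k} (_ ∷ pxs) (s≤s k<n) = All-nth0 pxs k<n

atMost-accept : ∀ {v x} xs → x ≤ v → atMost v (x ∷ xs) ≡ suc (atMost v xs)
atMost-accept {v} = count-accept (_≤? v)

atMost-reject : ∀ {v x} xs → x ≰ v → atMost v (x ∷ xs) ≡ atMost v xs
atMost-reject {v} = count-reject (_≤? v)

atLeast-accept : ∀ {v x} xs → v ≤ x → atLeast v (x ∷ xs) ≡ suc (atLeast v xs)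
atLeast-accept {v} = count-accept (v ≤?_)

atLeast-reject : ∀ {v x} xs → v ≰ x → atLeast v (x ∷ xs) ≡ atLeast v xs
atLeast-reject {v} = count-reject (v ≤?_)

nth0≤⇒<atMost : ∀ {s k v} → AllPairs _≤_ s → k < length s → nth0 s k ≤ v → k < atMost v s
nth0≤⇒<atMost {x ∷ xs} {zero}  _ _ x≤v =
  subst (0 <_) (sym (atMost-accept xs x≤v)) z<s
nth0≤⇒<atMost {x ∷ xs} {suc k} (x≤xs ∷ s) (s≤s k<n) xₖ≤v =
  subst (suc k <_) (sym (atMost-accept xs (≤-trans (All-nth0 x≤xs k<n) xₖ≤v)))
    (s≤s (nth0≤⇒<atMost s k<n xₖ≤v))

<atMost⇒nth0≤ : ∀ {s k v} → AllPairs _≤_ s → k < atMost v s → nth0 s k ≤ v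
<atMost⇒nth0≤ {x ∷ xs} {k} {v} (x≤xs ∷ s) k< with x ≤? v
... | no x≰v = contradiction (subst (k <_) (count-none (_≤? v) (x≰v ∷ All.map (λ x≤y → x≰v ∘ ≤-trans x≤y) x≤xs)) k<) n≮0
... | yes x≤v = within-tail k (subst (k <_) (atMost-accept xs x≤v) k<)
  where
  within-tail : ∀ k → k < suc (atMost v xs) → nth0 (x ∷ xs) k ≤ v
  within-tail zero    _        = x≤v
  within-tail (suc k) (s≤s k<) = <atMost⇒nth0≤ s k<

open InsertionSort ≤-decTotalOrder using (sort-↭; sort-↗)

sortℕ-pairwise : ∀ E → AllPairs _≤_ (sortℕ E)
sortℕ-pairwise E = Sorted⇒AllPairs ≤-totalOrder (sort-↗ E)

atMost-sortℕ : ∀ v E → atMost v (sortℕ E) ≡ atMost v E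
atMost-sortℕ v E = count-↭ (_≤? v) (sort-↭ E)

kth≤⇒<atMost : ∀ E {k v} → k < length E → kth E (suc k) ≤ v → k < atMost v E
kth≤⇒<atMost E {k} {v} k<n eₖ≤v = subst (k <_) (atMost-sortℕ v E)
  (nth0≤⇒<atMost (sortℕ-pairwise E) (subst (k <_) (sym (↭-length (sort-↭ E))) k<n) eₖ≤v)

<atMost⇒kth≤ : ∀ E {k v} → k < atMost v E → kth E (suc k) ≤ v
<atMost⇒kth≤ E {k} {v} k< = <atMost⇒nth0≤ (sortℕ-pairwise E) (subst (k <_) (sym (atMost-sortℕ v E)) k<)

kth≤⇒≤atMost : ∀ E {k v} → k ≤ length E → kth E k ≤ v → k ≤ atMost v E
kth≤⇒≤atMost E {zero}  _ _ = z≤n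
kth≤⇒≤atMost E {suc k} k≤n = kth≤⇒<atMost E k≤n

<kth⇒atMost< : ∀ E {k v} → v < kth E k → atMost v E < k
<kth⇒atMost< E {zero}  ()
<kth⇒atMost< E {suc k} v<eₖ = s≤s (≮⇒≥ (λ k<c → <⇒≱ v<eₖ (<atMost⇒kth≤ E k<c)))

∈⇒0<atMost : ∀ {E y} → y ∈ E → 0 < atMost y E
∈⇒0<atMost {y = y} y∈E = filter-some (_≤? y) (Any.map (λ y≡x → ≤-reflexive (sym y≡x)) y∈E)

kth-1∈ : ∀ E → 0 < length E → kth E 1 ∈ E
kth-1∈ E 0<n = ∈-resp-↭ (sort-↭ E) (head∈ (sortℕ E) (subst (0 <_) (sym (↭-length (sort-↭ E))) 0<n))
  where
  head∈ : ∀ s → 0 < length s → nth0 s 0 ∈ s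
  head∈ (x ∷ _) _ = here refl

atMost-suc : ∀ u {E} → Unique E → atMost (suc u) E ≤ suc (atMost u E)
atMost-suc u {[]} _ = z≤n
atMost-suc u {x ∷ xs} (x≢xs ∷ uxs) with <-cmp x (suc u)
... | tri< (s≤s x≤u) _ _ = begin
  atMost (suc u) (x ∷ xs) ≡⟨ atMost-accept xs (m≤n⇒m≤1+n x≤u) ⟩
  suc (atMost (suc u) xs) ≤⟨ s≤s (atMost-suc u uxs) ⟩
  suc (suc (atMost u xs)) ≡⟨ cong suc (atMost-accept xs x≤u) ⟨
  suc (atMost u (x ∷ xs)) ∎
  where open ≤-Reasoning
... | tri≈ _ refl _ = begin
  atMost (suc u) (x ∷ xs) ≡⟨ atMost-accept xs ≤-refl ⟩
  suc (atMost (suc u) xs) ≤⟨ s≤s (count-mono (_≤? suc u) (_≤? u) xs below) ⟩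
  suc (atMost u xs)       ≡⟨ cong suc (atMost-reject xs 1+n≰n) ⟨
  suc (atMost u (x ∷ xs)) ∎
  where
  open ≤-Reasoning
  below : ∀ {y} → y ∈ xs → y ≤ suc u → y ≤ u
  below y∈xs y≤1+u = ≤-pred (≤∧≢⇒< y≤1+u (All.lookup x≢xs y∈xs ∘ sym))
... | tri> _ _ 1+u<x = begin
  atMost (suc u) (x ∷ xs) ≡⟨ atMost-reject xs (<⇒≱ 1+u<x) ⟩
  atMost (suc u) xs       ≤⟨ atMost-suc u uxs ⟩
  suc (atMost u xs)       ≡⟨ cong suc (atMost-reject xs (<⇒≱ (<-trans (n<1+n u) 1+u<x))) ⟨
  suc (atMost u (x ∷ xs)) ∎
  where open ≤-Reasoning

atMost-kth : ∀ E {k} → Unique E → All (0 <_) E → k < length E → atMost (kth E (suc k)) E ≤ suc k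
atMost-kth E {k} uE pos k<n with kth E (suc k) in eₖ≡
... | zero = contradiction (subst (k <_) (count-none (_≤? 0) (All.map <⇒≱ pos)) (kth≤⇒<atMost E k<n (≤-reflexive eₖ≡))) n≮0
... | suc a = ≤-trans (atMost-suc a uE) (s≤s (≮⇒≥ λ k<atMost → 1+n≰n (subst (_≤ a) eₖ≡ (<atMost⇒kth≤ E k<atMost))))

atMost+atLeast : ∀ u S → atMost u S + atLeast (suc u) S ≡ length S
atMost+atLeast u [] = refl
atMost+atLeast u (y ∷ ys) with y ≤? u
... | yes y≤u = begin
  atMost u (y ∷ ys) + atLeast (suc u) (y ∷ ys) ≡⟨ cong₂ _+_ (atMost-accept ys y≤u) (atLeast-reject ys (<⇒≱ (s≤s y≤u))) ⟩
  suc (atMost u ys + atLeast (suc u) ys)       ≡⟨ cong suc (atMost+atLeast u ys) ⟩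
  suc (length ys)                              ∎
  where open ≡-Reasoning
... | no y≰u = begin
  atMost u (y ∷ ys) + atLeast (suc u) (y ∷ ys) ≡⟨ cong₂ _+_ (atMost-reject ys y≰u) (atLeast-accept ys (≰⇒> y≰u)) ⟩
  atMost u ys + suc (atLeast (suc u) ys)       ≡⟨ +-suc _ _ ⟩
  suc (atMost u ys + atLeast (suc u) ys)       ≡⟨ cong suc (atMost+atLeast u ys) ⟩
  suc (length ys)                              ∎
  where open ≡-Reasoning

atLeast-zero : ∀ S → atLeast 0 S ≡ length S
atLeast-zero S = cong length (filter-all (0 ≤?_) (All.universal (λ _ → z≤n) S))

-- The counting form of ≼, in which Q maintains the invariant A ≤ B.
_≼ᶜ_ : List ℕ → List ℕ → Set
E ≼ᶜ F = ∀ v → atMost v F ≤ atMost v E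

≼⇒≼ᶜ : ∀ {E F} → E ≼ F → E ≼ᶜ F
≼⇒≼ᶜ {E} {F} (|E|≡|F| , eₖ≤fₖ) v with atMost v F in count≡
... | zero  = z≤n
... | suc k = kth≤⇒<atMost E k<|E| (≤-trans (eₖ≤fₖ (suc k) (s≤s z≤n) k<|E|) (<atMost⇒kth≤ F (≤-reflexive (sym count≡))))
  where
  k<|E| : k < length E
  k<|E| = subst (k <_) (sym |E|≡|F|) (subst (_≤ length F) count≡ (length-filter (_≤? v) F))

≼⇒atLeast≤ : ∀ {E F} → E ≼ F → ∀ v → atLeast v E ≤ atLeast v F
≼⇒atLeast≤ {E} {F} E≼F zero = ≤-reflexive (begin
  atLeast 0 E ≡⟨ atLeast-zero E ⟩
  length E    ≡⟨ proj₁ E≼F ⟩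
  length F    ≡⟨ atLeast-zero F ⟨
  atLeast 0 F ∎)
  where open ≡-Reasoning
≼⇒atLeast≤ {E} {F} E≼F (suc u) = +-cancelˡ-≤ (atMost u E) _ _ (begin
  atMost u E + atLeast (suc u) E ≡⟨ atMost+atLeast u E ⟩
  length E                       ≡⟨ proj₁ E≼F ⟩
  length F                       ≡⟨ atMost+atLeast u F ⟨
  atMost u F + atLeast (suc u) F ≤⟨ +-monoˡ-≤ _ (≼⇒≼ᶜ {E} {F} E≼F u) ⟩
  atMost u E + atLeast (suc u) F ∎)
  where open ≤-Reasoning

-- The sub-procedure Q

module _ (A′ B : List ℕ) where

  maxQ-≤ : ∀ k → maxQ A′ B k ≤ k
  maxQ-≤ zero = z≤n
  maxQ-≤ (suc k) with kth B k <? kth A′ (suc k)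
  ... | yes _ = ≤-refl
  ... | no  _ = m≤n⇒m≤1+n (maxQ-≤ k)

  maxQ-witness : ∀ k {q} → maxQ A′ B k ≡ suc q → kth B q < kth A′ (suc q)
  maxQ-witness (suc k) q≡ with kth B k <? kth A′ (suc k)
  maxQ-witness (suc k) refl | yes bₖ<a′ₖ₊₁ = bₖ<a′ₖ₊₁
  ... | no _ = maxQ-witness k q≡

  maxQ-maximal : ∀ k {s} → maxQ A′ B k ≤ s → s < k → kth A′ (suc s) ≤ kth B s
  maxQ-maximal (suc k) {s} q≤s s<k with kth B k <? kth A′ (suc k)
  ... | yes _ = contradiction (≤-trans s<k q≤s) (n≮n s)
  ... | no bₖ≮a′ₖ₊₁ with m≤n⇒m<n∨m≡n (≤-pred s<k)
  ...   | inj₁ s<k′  = maxQ-maximal k q≤s s<k′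
  ...   | inj₂ refl = ≮⇒≥ bₖ≮a′ₖ₊₁

module Qstep {A B : List ℕ} {γ : ℕ} (|A|≡|B| : length A ≡ length B) (A≼B : A ≼ᶜ B)
             (positive : All (0 <_) (γ ∷ A)) where

  private
    A′ : List ℕ
    A′ = γ ∷ A

    t : ℕ
    t = length A

    q : ℕ
    q = maxQ A′ B (suc t)

    0<q : 0 < q
    0<q = ≰⇒> λ q≤0 → <⇒≱ (All.lookup positive (kth-1∈ A′ z<s)) (maxQ-maximal A′ B (suc t) q≤0 z<s)

    r : ℕ
    r = pred q

    q≡1+r : q ≡ suc r
    q≡1+r = sym (suc-pred q {{>-nonZero 0<q}})

    r≤t : r ≤ t
    r≤t = ≤-pred (subst (_≤ suc t) q≡1+r (maxQ-≤ A′ B (suc t)))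

    Qout≡ : Qout A B γ ≡ kth A′ (suc r)
    Qout≡ = cong (kth A′) q≡1+r

    bᵣ<Qout : kth B r < Qout A B γ
    bᵣ<Qout = subst (kth B r <_) (sym Qout≡) (maxQ-witness A′ B (suc t) q≡1+r)

    r≤|B| : r ≤ length B
    r≤|B| = subst (r ≤_) |A|≡|B| r≤t

  Qout≤⇒atMost< : ∀ {u} → Qout A B γ ≤ u → atMost u B < atMost u A′
  Qout≤⇒atMost< {u} x≤u with m≤n⇒m<n∨m≡n (length-filter (_≤? u) A′)
  ... | inj₂ c≡1+t = subst (atMost u B <_) (sym c≡1+t) (s≤s (subst (atMost u B ≤_) (sym |A|≡|B|) (length-filter (_≤? u) B)))
  ... | inj₁ (s≤s c≤t) = <kth⇒atMost< B (begin-strict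
    u                           <⟨ ≰⇒> (n≮n (atMost u A′) ∘ kth≤⇒<atMost A′ (s≤s c≤t)) ⟩
    kth A′ (suc (atMost u A′))  ≤⟨ maxQ-maximal A′ B (suc t) q≤c (s≤s c≤t) ⟩
    kth B (atMost u A′)         ∎)
    where
    open ≤-Reasoning
    q≤c : q ≤ atMost u A′
    q≤c = subst (_≤ atMost u A′) (sym q≡1+r) (kth≤⇒<atMost A′ (s≤s r≤t) (subst (_≤ u) Qout≡ x≤u))

  atMost-Qout : Unique A′ → atMost (Qout A B γ) A′ ≤ suc (atMost (Qout A B γ) B)
  atMost-Qout distinct = begin
    atMost (Qout A B γ) A′      ≡⟨ cong (λ v → atMost v A′) Qout≡ ⟩
    atMost (kth A′ (suc r)) A′  ≤⟨ atMost-kth A′ distinct positive (s≤s r≤t) ⟩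
    suc r                       ≤⟨ s≤s (kth≤⇒≤atMost B r≤|B| (<⇒≤ bᵣ<Qout)) ⟩
    suc (atMost (Qout A B γ) B) ∎
    where open ≤-Reasoning

  -- Count at the threshold x - 1: A′ has at most r elements there, while b_r and A ≤ B
  -- already give r elements of A, and γ is one more.
  Qout≤γ : Qout A B γ ≤ γ
  Qout≤γ = ≮⇒≥ λ γ<x → 1+n≰n (begin
    suc r                 ≤⟨ s≤s (kth≤⇒≤atMost B r≤|B| (suc[m]≤n⇒m≤pred[n] bᵣ<Qout)) ⟩
    suc (atMost u B)      ≤⟨ s≤s (A≼B u) ⟩
    suc (atMost u A)      ≡⟨ atMost-accept A (suc[m]≤n⇒m≤pred[n] γ<x) ⟨
    atMost u A′           ≤⟨ ≮⇒≥ (λ r<c → <⇒≱ (u<x γ<x) (subst (_≤ u) (sym Qout≡) (<atMost⇒kth≤ A′ r<c))) ⟩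
    r                     ∎)
    where
    open ≤-Reasoning
    u : ℕ
    u = pred (Qout A B γ)
    u<x : γ < Qout A B γ → u < Qout A B γ
    u<x γ<x = ≤-reflexive (suc-pred (Qout A B γ) {{>-nonZero (≤-trans (s≤s z≤n) γ<x)}})

  Q-preserves-≼ᶜ : A′ ≼ᶜ (Qout A B γ ∷ B)
  Q-preserves-≼ᶜ v with Qout A B γ ≤? v
  ... | yes x≤v = subst (_≤ atMost v A′) (sym (atMost-accept B x≤v)) (Qout≤⇒atMost< x≤v)
  ... | no  x≰v = subst (_≤ atMost v A′) (sym (atMost-reject B x≰v)) (≤-trans (A≼B v) (count-∷ (_≤? v) γ A))

Unique-++⁻ˡ : ∀ xs {ys : List ℕ} → Unique (xs ++ ys) → Unique xs
Unique-++⁻ˡ []       _            = []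
Unique-++⁻ˡ (x ∷ xs) (x∉ ∷ uxys) = ++⁻ˡ xs x∉ ∷ Unique-++⁻ˡ xs uxys

record QrunInv (A B gs : List ℕ) : Set where
  field
    lengths   : length A ≡ length B
    dominated : A ≼ᶜ B
    distinct  : Unique (A ++ gs)
    positive  : All (0 <_) (A ++ gs)

QrunInv-step : ∀ {A B γ gs} → QrunInv A B (γ ∷ gs) → QrunInv (γ ∷ A) (Qout A B γ ∷ B) gs
QrunInv-step {A} {B} {γ} {gs} I = record
  { lengths   = cong suc lengths
  ; dominated = Qstep.Q-preserves-≼ᶜ lengths dominated (++⁻ˡ (γ ∷ A) positive′)
  ; distinct  = Unique-resp-↭ (↭⇒↭ₛ (shift γ A gs)) distinct
  ; positive  = positive′
  }
  where
  open QrunInv I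
  positive′ : All (0 <_) (γ ∷ A ++ gs)
  positive′ = All-resp-↭ (shift γ A gs) positive

-- Indices are 0-based: AscentAt xs j says at xs (suc j) < at xs (suc (suc j)).
AscentAt : List ℕ → ℕ → Set
AscentAt xs k = nth0 xs k < nth0 xs (suc k)

Qout-ascent : ∀ {A B γ₁ γ₂ gs} → QrunInv A B (γ₁ ∷ γ₂ ∷ gs) → γ₁ < γ₂ →
              Qout A B γ₁ < Qout (γ₁ ∷ A) (Qout A B γ₁ ∷ B) γ₂
Qout-ascent {A} {B} {γ₁} {γ₂} I γ₁<γ₂ = ≰⇒> λ x₂≤x₁ → n≮n _ (begin-strict
  suc (atMost x₁ B)         ≡⟨ atMost-accept B ≤-refl ⟨
  atMost x₁ (x₁ ∷ B)        <⟨ Qstep.Qout≤⇒atMost< I₁.lengths I₁.dominated (++⁻ˡ (γ₂ ∷ γ₁ ∷ A) I₂.positive) x₂≤x₁ ⟩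
  atMost x₁ (γ₂ ∷ γ₁ ∷ A)   ≡⟨ atMost-reject (γ₁ ∷ A) (<⇒≱ (≤-<-trans x₁≤γ₁ γ₁<γ₂)) ⟩
  atMost x₁ (γ₁ ∷ A)        ≤⟨ Qstep.atMost-Qout I.lengths I.dominated γ₁A-positive (Unique-++⁻ˡ (γ₁ ∷ A) I₁.distinct) ⟩
  suc (atMost x₁ B)         ∎)
  where
  open ≤-Reasoning
  module I  = QrunInv I
  module I₁ = QrunInv (QrunInv-step I)
  module I₂ = QrunInv (QrunInv-step (QrunInv-step I))
  x₁ : ℕ
  x₁ = Qout A B γ₁
  γ₁A-positive : All (0 <_) (γ₁ ∷ A)
  γ₁A-positive = ++⁻ˡ (γ₁ ∷ A) I₁.positive
  x₁≤γ₁ : x₁ ≤ γ₁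
  x₁≤γ₁ = Qstep.Qout≤γ I.lengths I.dominated γ₁A-positive

Qrun-preserves-ascent : ∀ {A B gs k} → QrunInv A B gs → AscentAt gs k → AscentAt (Qrun A B gs) k
Qrun-preserves-ascent {gs = []}                _ ()
Qrun-preserves-ascent {gs = _ ∷ []}    {zero}  _ ()
Qrun-preserves-ascent {gs = _ ∷ _ ∷ _} {zero}  I γ₁<γ₂ = Qout-ascent I γ₁<γ₂
Qrun-preserves-ascent {gs = _ ∷ _}     {suc k} I asc   = Qrun-preserves-ascent (QrunInv-step I) asc

-- The greedy phase

notIn? : (used : List ℕ) → Decidable (_∉ used)
notIn? used y = ¬? (y ∈? used)

remaining : List ℕ → List ℕ → List ℕ
remaining Y used = filter (notIn? used) Y

remaining-[] : ∀ Y → remaining Y [] ≡ Y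
remaining-[] Y = filter-all (notIn? []) (All.universal (λ _ ()) Y)

remaining-fresh : ∀ {m} used ys → All (m ≢_) ys → remaining ys (m ∷ used) ≡ remaining ys used
remaining-fresh used []       []           = refl
remaining-fresh {m} used (y ∷ ys) (m≢y ∷ m≢ys) = by-cases (y ∈? used)
  where
  open ≡-Reasoning
  by-cases : Dec (y ∈ used) → remaining (y ∷ ys) (m ∷ used) ≡ remaining (y ∷ ys) used
  by-cases (yes y∈) = begin
    remaining (y ∷ ys) (m ∷ used) ≡⟨ filter-reject (notIn? (m ∷ used)) (λ y∉ → y∉ (there y∈)) ⟩
    remaining ys (m ∷ used)       ≡⟨ remaining-fresh used ys m≢ys ⟩
    remaining ys used             ≡⟨ filter-reject (notIn? used) (λ y∉ → y∉ y∈) ⟨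
    remaining (y ∷ ys) used       ∎
  by-cases (no y∉) = begin
    remaining (y ∷ ys) (m ∷ used) ≡⟨ filter-accept (notIn? (m ∷ used)) y∉m∷used ⟩
    y ∷ remaining ys (m ∷ used)   ≡⟨ cong (y ∷_) (remaining-fresh used ys m≢ys) ⟩
    y ∷ remaining ys used         ≡⟨ filter-accept (notIn? used) y∉ ⟨
    remaining (y ∷ ys) used       ∎
    where
    y∉m∷used : y ∉ m ∷ used
    y∉m∷used (here y≡m) = m≢y (sym y≡m)
    y∉m∷used (there y∈) = y∉ y∈

remaining-remove : ∀ {Y used m} → Unique Y → m ∈ remaining Y used →
                   remaining Y used ↭ m ∷ remaining Y (m ∷ used)
remaining-remove {y ∷ ys} {used} {m} (y≢ys ∷ uys) m∈R = by-cases (y ∈? used) (y ≟ m)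
  where
  open PermutationReasoning
  by-cases : Dec (y ∈ used) → Dec (y ≡ m) → remaining (y ∷ ys) used ↭ m ∷ remaining (y ∷ ys) (m ∷ used)
  by-cases (yes y∈) _ = begin
    remaining (y ∷ ys) used           ≡⟨ filter-reject (notIn? used) (λ y∉ → y∉ y∈) ⟩
    remaining ys used                 ↭⟨ remaining-remove uys (subst (m ∈_) (filter-reject (notIn? used) (λ y∉ → y∉ y∈)) m∈R) ⟩
    m ∷ remaining ys (m ∷ used)       ≡⟨ cong (m ∷_) (filter-reject (notIn? (m ∷ used)) (λ y∉ → y∉ (there y∈))) ⟨
    m ∷ remaining (y ∷ ys) (m ∷ used) ∎
  by-cases (no y∉) (yes refl) = begin
    remaining (y ∷ ys) used           ≡⟨ filter-accept (notIn? used) y∉ ⟩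
    y ∷ remaining ys used             ≡⟨ cong (y ∷_) (remaining-fresh used ys y≢ys) ⟨
    y ∷ remaining ys (y ∷ used)       ≡⟨ cong (y ∷_) (filter-reject (notIn? (y ∷ used)) (λ y∉ → y∉ (here refl))) ⟨
    y ∷ remaining (y ∷ ys) (y ∷ used) ∎
  by-cases (no y∉) (no y≢m) = begin
    remaining (y ∷ ys) used           ≡⟨ filter-accept (notIn? used) y∉ ⟩
    y ∷ remaining ys used             <⟨ remaining-remove uys m∈R′ ⟩
    y ∷ m ∷ remaining ys (m ∷ used)   <<⟨ ↭-refl ⟩
    m ∷ y ∷ remaining ys (m ∷ used)   ≡⟨ cong (m ∷_) (filter-accept (notIn? (m ∷ used)) y∉m∷used) ⟨
    m ∷ remaining (y ∷ ys) (m ∷ used) ∎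
    where
    m∈R′ : m ∈ remaining ys used
    m∈R′ with subst (m ∈_) (filter-accept (notIn? used) y∉) m∈R
    ... | here m≡y = contradiction (sym m≡y) y≢m
    ... | there m∈ = m∈
    y∉m∷used : y ∉ m ∷ used
    y∉m∷used (here y≡m) = y≢m y≡m
    y∉m∷used (there y∈) = y∉ y∈

module LeastGE {S : List ℕ} {x : ℕ} (0<c : 0 < atLeast x S) where

  private
    leastGE∈filter : leastGE S x ∈ filter (x ≤?_) S
    leastGE∈filter = kth-1∈ (filter (x ≤?_) S) 0<c

  leastGE∈ : leastGE S x ∈ S
  leastGE∈ = proj₁ (∈-filter⁻ (x ≤?_) {xs = S} leastGE∈filter)

  ≤leastGE : x ≤ leastGE S x
  ≤leastGE = proj₂ (∈-filter⁻ (x ≤?_) {xs = S} leastGE∈filter)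

  leastGE-least : ∀ {y} → y ∈ S → x ≤ y → leastGE S x ≤ y
  leastGE-least y∈S x≤y = <atMost⇒kth≤ (filter (x ≤?_) S) (∈⇒0<atMost (∈-filter⁺ (x ≤?_) y∈S x≤y))

-- Hall's condition for matching the entries of xs to distinct remaining elements of Y
-- weakly above them.
Matchable : List ℕ → List ℕ → List ℕ → Set
Matchable Y used xs = ∀ v → atLeast v xs ≤ atLeast v (remaining Y used)

module GreedyStep {Y used x xs} (distinct : Unique Y) (match : Matchable Y used (x ∷ xs)) where

  R : List ℕ
  R = remaining Y used

  0<atLeast : 0 < atLeast x R
  0<atLeast = ≤-trans (s≤s z≤n) (subst (_≤ atLeast x R) (atLeast-accept {x} xs ≤-refl) (match x))

  open LeastGE {R} {x} 0<atLeast public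

  m : ℕ
  m = leastGE R x

  R′ : List ℕ
  R′ = remaining Y (m ∷ used)

  R↭m∷R′ : R ↭ m ∷ R′
  R↭m∷R′ = remaining-remove distinct leastGE∈

  private
    ≤m⇒atLeast< : ∀ {v} → v ≤ m → atLeast v xs < atLeast v R
    ≤m⇒atLeast< {v} v≤m with v ≤? x
    ... | yes v≤x = subst (_≤ atLeast v R) (atLeast-accept xs v≤x) (match v)
    ... | no  v≰x = begin
      suc (atLeast v xs)  ≤⟨ s≤s (count-mono (v ≤?_) (x ≤?_) xs (λ _ → ≤-trans x≤v)) ⟩
      suc (atLeast x xs)  ≡⟨ atLeast-accept xs ≤-refl ⟨
      atLeast x (x ∷ xs)  ≤⟨ match x ⟩
      atLeast x R         ≤⟨ count-mono (x ≤?_) (v ≤?_) R (λ y∈R x≤y → ≤-trans v≤m (leastGE-least y∈R x≤y)) ⟩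
      atLeast v R         ∎
      where
      open ≤-Reasoning
      x≤v : x ≤ v
      x≤v = <⇒≤ (≰⇒> v≰x)

  matchable′ : Matchable Y (m ∷ used) xs
  matchable′ v with v ≤? m
  ... | yes v≤m = ≤-pred (begin
    suc (atLeast v xs)  ≤⟨ ≤m⇒atLeast< v≤m ⟩
    atLeast v R         ≡⟨ count-↭ (v ≤?_) R↭m∷R′ ⟩
    atLeast v (m ∷ R′)  ≡⟨ atLeast-accept R′ v≤m ⟩
    suc (atLeast v R′)  ∎)
    where open ≤-Reasoning
  ... | no v≰m = begin
    atLeast v xs        ≤⟨ count-∷ (v ≤?_) x xs ⟩
    atLeast v (x ∷ xs)  ≤⟨ match v ⟩
    atLeast v R         ≡⟨ count-↭ (v ≤?_) R↭m∷R′ ⟩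
    atLeast v (m ∷ R′)  ≡⟨ atLeast-reject R′ v≰m ⟩
    atLeast v R′        ∎
    where open ≤-Reasoning

greedy-preserves-ascent : ∀ {Y used xs k} → Unique Y → Matchable Y used xs →
                          AscentAt xs k → AscentAt (greedy Y used xs) k
greedy-preserves-ascent {xs = []}             _ _ ()
greedy-preserves-ascent {xs = _ ∷ []} {zero} _ _ ()
greedy-preserves-ascent {Y} {used} {x₁ ∷ x₂ ∷ xs} {zero} distinct match x₁<x₂ =
  ≤∧≢⇒< (S₁.leastGE-least m₂∈R (≤-trans (<⇒≤ x₁<x₂) S₂.≤leastGE)) (λ m₁≡m₂ → m₂∉m₁∷used (here (sym m₁≡m₂)))
  where
  module S₁ = GreedyStep {Y} {used} {x₁} {x₂ ∷ xs} distinct match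
  module S₂ = GreedyStep {Y} {S₁.m ∷ used} {x₂} {xs} distinct S₁.matchable′
  m₂∉m₁∷used : S₂.m ∉ S₁.m ∷ used
  m₂∉m₁∷used = proj₂ (∈-filter⁻ (notIn? (S₁.m ∷ used)) {xs = Y} S₂.leastGE∈)
  m₂∈R : S₂.m ∈ S₁.R
  m₂∈R = ∈-resp-↭ (↭-sym S₁.R↭m∷R′) (there S₂.leastGE∈)
greedy-preserves-ascent {Y} {used} {x ∷ xs} {suc k} distinct match asc =
  greedy-preserves-ascent {xs = xs} {k} distinct (GreedyStep.matchable′ {Y} {used} {x} {xs} distinct match) asc

-- Positions and truncation

at-take : ∀ {N xs i} → i ≤ N → at (take N xs) i ≡ at xs i
at-take {i = zero} _ = refl
at-take {suc N} {[]}     {suc i} _ = refl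
at-take {suc N} {x ∷ xs} {suc zero} _ = refl
at-take {suc N} {x ∷ xs} {suc (suc i)} (s≤s i<N) = at-take {N} {xs} {suc i} i<N

at≡⇒take≡ : ∀ N {xs ys} → N ≤ length xs → N ≤ length ys →
            (∀ i → 1 ≤ i → i ≤ N → at xs i ≡ at ys i) → take N xs ≡ take N ys
at≡⇒take≡ zero    _ _ _ = refl
at≡⇒take≡ (suc N) {x ∷ xs} {y ∷ ys} (s≤s N≤|xs|) (s≤s N≤|ys|) agree =
  cong₂ _∷_ (agree 1 ≤-refl (s≤s z≤n))
            (at≡⇒take≡ N N≤|xs| N≤|ys| λ { (suc i) _ i≤N → agree (suc (suc i)) (s≤s z≤n) (s≤s i≤N) })

take-preserves-ascent : ∀ {p xs k} → suc k < p → AscentAt xs k → AscentAt (take p xs) k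
take-preserves-ascent {p} {xs} {k} 2+k≤p = subst₂ _<_ (sym (at-take {p} {xs} {suc k} (<⇒≤ 2+k≤p))) (sym (at-take {p} {xs} {suc (suc k)} 2+k≤p))

drop-preserves-ascent : ∀ p {xs k} → AscentAt xs (p + k) → AscentAt (drop p xs) k
drop-preserves-ascent zero               asc = asc
drop-preserves-ascent (suc p) {[]}       ()
drop-preserves-ascent (suc p) {_ ∷ xs}   asc = drop-preserves-ascent p {xs} asc

++ˡ-preserves-ascent : ∀ {xs k} ys → suc k < length xs → AscentAt xs k → AscentAt (xs ++ ys) k
++ˡ-preserves-ascent {_ ∷ _ ∷ _} {zero}  ys _           asc = asc
++ˡ-preserves-ascent {_ ∷ xs}    {suc k} ys (s≤s 1+k<n) asc = ++ˡ-preserves-ascent {xs} {k} ys 1+k<n asc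

++ʳ-preserves-ascent : ∀ xs {ys k} → AscentAt ys k → AscentAt (xs ++ ys) (length xs + k)
++ʳ-preserves-ascent []       asc = asc
++ʳ-preserves-ascent (_ ∷ xs) asc = ++ʳ-preserves-ascent xs asc

greedy-length : ∀ Y used xs → length (greedy Y used xs) ≡ length xs
greedy-length Y used []       = refl
greedy-length Y used (x ∷ xs) = cong suc (greedy-length Y _ xs)

take-greedy : ∀ N Y used xs → take N (greedy Y used xs) ≡ greedy Y used (take N xs)
take-greedy zero    Y used xs       = refl
take-greedy (suc N) Y used []       = refl
take-greedy (suc N) Y used (x ∷ xs) = cong (_ ∷_) (take-greedy N Y _ xs)

take-Qrun : ∀ N A B gs → take N (Qrun A B gs) ≡ Qrun A B (take N gs)
take-Qrun zero    A B gs       = refl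
take-Qrun (suc N) A B []       = refl
take-Qrun (suc N) A B (γ ∷ gs) = cong (_ ∷_) (take-Qrun N _ _ gs)

take-++ : ∀ N (xs ys : List ℕ) → take N (xs ++ ys) ≡ take N xs ++ take (N ∸ length xs) ys
take-++ zero    []       ys = refl
take-++ zero    (x ∷ xs) ys = refl
take-++ (suc N) []       ys = refl
take-++ (suc N) (x ∷ xs) ys = cong (x ∷_) (take-++ N xs ys)

take-comm : ∀ N p (xs : List ℕ) → take N (take p xs) ≡ take p (take N xs)
take-comm N p xs = trans (take-take N p xs) (trans (cong (λ k → take k xs) (⊓-comm N p)) (sym (take-take p N xs)))

length-take-≤ : ∀ {p} {w : List ℕ} → p ≤ length w → length (take p w) ≡ p
length-take-≤ {p} {w} p≤|w| = trans (length-take p w) (m≤n⇒m⊓n≡m p≤|w|)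

length-greedy-take : ∀ {p Y used} {w : List ℕ} → p ≤ length w → length (greedy Y used (take p w)) ≡ p
length-greedy-take {p} {Y} {used} {w} p≤|w| = trans (greedy-length Y used (take p w)) (length-take-≤ p≤|w|)

module _ (p : ℕ) (Y w : List ℕ) where

  Qrun-take : ∀ N → Qrun (take p w) Y (take (N ∸ p) (drop p w)) ≡ Qrun (take p (take N w)) Y (drop p (take N w))
  Qrun-take N with ≤-total N p
  ... | inj₁ N≤p = begin
    Qrun (take p w) Y (take (N ∸ p) (drop p w))     ≡⟨ cong (λ k → Qrun (take p w) Y (take k (drop p w))) (m≤n⇒m∸n≡0 N≤p) ⟩
    []                                              ≡⟨ cong (Qrun (take p (take N w)) Y) (drop-all p (take N w) |take|≤p) ⟨
    Qrun (take p (take N w)) Y (drop p (take N w))  ∎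
    where
    open ≡-Reasoning
    |take|≤p : length (take N w) ≤ p
    |take|≤p = ≤-trans (≤-reflexive (length-take N w)) (≤-trans (m⊓n≤m N (length w)) N≤p)
  ... | inj₂ p≤N = cong₂ (λ A gs → Qrun A Y gs)
    (trans (cong (λ k → take k w) (sym (m≤n⇒m⊓n≡m p≤N))) (sym (take-take p N w)))
    (trans (take-drop (N ∸ p) p w) (cong (λ k → drop p (take k w)) (m+[n∸m]≡n p≤N)))

  take-minLift : p ≤ length w → ∀ N → take N (minLift p Y w) ≡ minLift p Y (take N w)
  take-minLift p≤|w| N = begin
    take N (G ++ R)                                     ≡⟨ take-++ N G R ⟩
    take N G ++ take (N ∸ length G) R                   ≡⟨ cong (λ k → take N G ++ take (N ∸ k) R) (length-greedy-take p≤|w|) ⟩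
    take N G ++ take (N ∸ p) R                          ≡⟨ cong₂ _++_ (take-greedy N Y [] (take p w)) (take-Qrun (N ∸ p) (take p w) Y (drop p w)) ⟩
    greedy Y [] (take N (take p w)) ++ Qrun (take p w) Y (take (N ∸ p) (drop p w))
                                                        ≡⟨ cong₂ _++_ (cong (greedy Y []) (take-comm N p w)) (Qrun-take N) ⟩
    minLift p Y (take N w)                              ∎
    where
    open ≡-Reasoning
    G R : List ℕ
    G = greedy Y [] (take p w)
    R = Qrun (take p w) Y (drop p w)

module _ {p Y w} (Y-distinct : Unique Y) (|Y|≡p : length Y ≡ p) (w-distinct : Unique w)
         (w-positive : All (0 <_) w) (p≤|w| : p ≤ length w) (w≼Y : take p w ≼ Y) where

  private
    G R : List ℕ
    G = greedy Y [] (take p w)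
    R = Qrun (take p w) Y (drop p w)

    |G|≡p : length G ≡ p
    |G|≡p = length-greedy-take p≤|w|

    matchable : Matchable Y [] (take p w)
    matchable v = subst (λ Y′ → atLeast v (take p w) ≤ atLeast v Y′) (sym (remaining-[] Y)) (≼⇒atLeast≤ {take p w} {Y} w≼Y v)

    invariant : QrunInv (take p w) Y (drop p w)
    invariant = record
      { lengths   = trans (length-take-≤ p≤|w|) (sym |Y|≡p)
      ; dominated = ≼⇒≼ᶜ {take p w} {Y} w≼Y
      ; distinct  = subst Unique (sym (take++drop≡id p w)) w-distinct
      ; positive  = subst (All (0 <_)) (sym (take++drop≡id p w)) w-positive
      }

  minLift-preserves-ascent : ∀ {j} → suc j ≢ p → AscentAt w j → AscentAt (minLift p Y w) j
  minLift-preserves-ascent {j} 1+j≢p asc with <-cmp (suc j) p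
  ... | tri< 1+j<p _ _ = ++ˡ-preserves-ascent {G} R (subst (suc j <_) (sym |G|≡p) 1+j<p)
        (greedy-preserves-ascent {xs = take p w} {j} Y-distinct matchable (take-preserves-ascent {p} {w} 1+j<p asc))
  ... | tri≈ _ 1+j≡p _ = contradiction 1+j≡p 1+j≢p
  ... | tri> _ _ p<1+j = subst (AscentAt (G ++ R)) (trans (cong (_+ (j ∸ p)) |G|≡p) p+[j∸p]≡j)
        (++ʳ-preserves-ascent G {R} (Qrun-preserves-ascent {k = j ∸ p} invariant
          (drop-preserves-ascent p {w} {j ∸ p} (subst (AscentAt w) (sym p+[j∸p]≡j) asc))))
    where
    p+[j∸p]≡j : p + (j ∸ p) ≡ j
    p+[j∸p]≡j = m+[n∸m]≡n (≤-pred p<1+j)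

minLift-causal : ∀ {p Y w w′ N i} → p ≤ length w → p ≤ length w′ → take N w′ ≡ take N w → i ≤ N →
                 at (minLift p Y w′) i ≡ at (minLift p Y w) i
minLift-causal {p} {Y} {w} {w′} {N} {i} p≤|w| p≤|w′| w′≡w i≤N = begin
  at (minLift p Y w′) i           ≡⟨ at-take i≤N ⟨
  at (take N (minLift p Y w′)) i  ≡⟨ cong (λ ξ → at ξ i) (take-minLift p Y w′ p≤|w′| N) ⟩
  at (minLift p Y (take N w′)) i  ≡⟨ cong (λ u → at (minLift p Y u) i) w′≡w ⟩
  at (minLift p Y (take N w)) i   ≡⟨ cong (λ ξ → at ξ i) (take-minLift p Y w p≤|w| N) ⟨
  at (take N (minLift p Y w)) i   ≡⟨ at-take i≤N ⟩
  at (minLift p Y w) i            ∎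
  where open ≡-Reasoning

module _ {n w} (w↭ : w ↭ range1 n) where

  ↭range1⇒length : length w ≡ n
  ↭range1⇒length = trans (↭-length w↭) (trans (length-map suc (upTo n)) (length-upTo n))

  ↭range1⇒distinct : Unique w
  ↭range1⇒distinct = Unique-resp-↭ (↭⇒↭ₛ (↭-sym w↭)) (Unique.map⁺ suc-injective (Unique.upTo⁺ n))

  ↭range1⇒positive : All (0 <_) w
  ↭range1⇒positive = All-resp-↭ (↭-sym w↭) (map⁺ (All.universal (λ _ → z<s) (upTo n)))

  ≤n⇒≤length : ∀ {k} → k ≤ n → k ≤ length w
  ≤n⇒≤length = subst (_ ≤_) (sym ↭range1⇒length)

lemma6p4 : (n p : ℕ) → 1 ≤ p → p ≤ n →
    (Y : List ℕ) → Unique Y → All (λ y → 1 ≤ y × y ≤ n) Y → length Y ≡ p →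
    (w : List ℕ) → w ↭ range1 n → take p w ≼ Y →
    ((i : ℕ) → 1 ≤ i → i < n → i ≢ p → at w i < at w (suc i) →
        at (minLift p Y w) i < at (minLift p Y w) (suc i))
    ×
    ((w' : List ℕ) → w' ↭ range1 n → take p w' ≼ Y →
      (N : ℕ) → N ≤ n → ((i : ℕ) → 1 ≤ i → i ≤ N → at w' i ≡ at w i) →
      (i : ℕ) → 1 ≤ i → i ≤ N → at (minLift p Y w') i ≡ at (minLift p Y w) i)
lemma6p4 n p _ p≤n Y Y-distinct _ |Y|≡p w w↭ w≼Y =
  (λ { (suc j) _ _ 1+j≢p → minLift-preserves-ascent Y-distinct |Y|≡p (↭range1⇒distinct w↭)
                             (↭range1⇒positive w↭) (≤n⇒≤length w↭ p≤n) w≼Y 1+j≢p })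
  , λ w′ w′↭ _ N N≤n agree _ _ i≤N →
      minLift-causal (≤n⇒≤length w↭ p≤n) (≤n⇒≤length w′↭ p≤n)
        (at≡⇒take≡ N (≤n⇒≤length w′↭ N≤n) (≤n⇒≤length w↭ N≤n) agree) i≤N
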